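{- Let $d>1$ be an integer and let $\mathfrak{V}_{\leq d}^{\Leftrightarrow}$ be the set of bi-infinite binary strings of VC dimension at most $d$. Then the shift space $\mathfrak{V}_{\leq d}^{\Leftrightarrow}$ is not sofic.
   Context: For a finite binary string $s$ (indexed from $0$), let $n(s)=\{i: s_i=1\}\subseteq\mathbb{N}$. For a (finite, infinite, or bi-infinite) binary string $S$, let $\mathfrak{S}=\{n(s): s \text{ a finite contiguous substring of } S\}$. A set $B\subseteq\mathbb{N}$ is shattered if $\{c\cap B: c\in\mathfrak{S}\}$ is the power set of $B$; the VC dimension of $S$ is the largest size of a shattered set ($\infty$ if none is largest). $\mathfrak{V}_{\leq d}^{\Leftrightarrow}\subseteq\{0,1\}^{\mathbb{Z}}$ is closed and shift-invariant, hence a shift space. A shift space $X\subseteq\{0,1\}^{\mathbb{Z}}$ is sofic iff it has only finitely many distinct follower sets, where, with $B(X)$ the set of finite words occurring in elements of $X$, the follower set of $w\in B(X)$ is $F_X(w)=\{z\in B(X): wz\in B(X)\}$ (equivalently, $X$ is a factor of a shift of finite type). -}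

module Defs where

open import Data.Bool using (Bool; true; false)
open import Data.Nat using (ℕ; _<_; _≤_)
open import Data.Integer using (ℤ; +_) renaming (_+_ to _+ℤ_)
open import Data.List using (List; length; map; upTo; _++_)
open import Data.List.Membership.Propositional using (_∈_)
open import Data.List.Relation.Unary.Unique.Propositional using (Unique)
open import Data.List.Relation.Unary.All using (All)
open import Data.List.Relation.Unary.Any using (Any)
open import Data.Product using (Σ; _×_)
open import Function.Bundles using (_⇔_)
open import Relation.Binary.PropositionalEquality using (_≡_)

Seq : Set
Seq = ℤ → Bool

Word : Set
Word = List Bool

-- The finite contiguous substring s of S starting at position i with length L
-- is  s_k = S (i + k)  for k < L.  Then  b ∈ n(s)  iff  b < L and S (i + b) = 1.
InN : Seq → ℤ → ℕ → ℕ → Set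
InN S i L b = (b < L) × (S (i +ℤ (+ b)) ≡ true)

-- A finite set B ⊆ ℕ (a duplicate-free list) is shattered by S if every subset
-- of B (given by its characteristic function f) is cut out as n(s) ∩ B for some
-- finite contiguous substring s of S.
-- (Infinite sets can never be shattered, since every n(s) is finite.)
Shattered : Seq → List ℕ → Set
Shattered S B =
  (f : ℕ → Bool) →
  Σ ℤ λ i → Σ ℕ λ L → (b : ℕ) → b ∈ B → (InN S i L b ⇔ (f b ≡ true))

VCAtMost : ℕ → Seq → Set
VCAtMost d S = (B : List ℕ) → Unique B → Shattered S B → length B ≤ d

V≤ : ℕ → Seq → Set
V≤ d S = VCAtMost d S

OccursIn : Word → Seq → Set
OccursIn w S = Σ ℤ λ i → w ≡ map (λ k → S (i +ℤ (+ k))) (upTo (length w))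

Lang : (Seq → Set) → Word → Set
Lang X w = Σ Seq λ S → X S × OccursIn w S

Follower : (Seq → Set) → Word → Word → Set
Follower X w z = Lang X z × Lang X (w ++ z)

SameFollower : (Seq → Set) → Word → Word → Set
SameFollower X w v = (z : Word) → Follower X w z ⇔ Follower X v z

-- X is sofic: X has only finitely many distinct follower sets, i.e. there is a
-- finite list of words of B(X) whose follower sets exhaust all follower sets.
Sofic : (Seq → Set) → Set
Sofic X =
  Σ (List Word) λ ws → All (Lang X) ws ×
    ((w : Word) → Lang X w → Any (SameFollower X w) ws)

-- Blowing a sequence up by 1 ↦ 110, 0 ↦ 000 enlarges its shattered sets by exactly one point:
-- behind a 1, a new offset 1 reads off the place of that 1 inside its block, and conversely,
-- read one level down, a shattered set of the blow-up loses at most the offset that reads this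
-- place.  With a = 1 + m and b = 1 + n, the sequence base m n has its 1s at c, c + a left of a
-- cut and at two places b apart right of it.  For m ≠ n all differences of these four points are
-- distinct, so no 3-set is shattered and the N-fold blow-up lies in 𝔙_{≤ N+2}; for m = n they
-- form the sumset {c, 2c} + {0, a}, which shatters a 3-set, so the blown-up window shatters a set
-- of size N + 3.  Hence the blown-up left part of base m _ can be followed by the blown-up right
-- part of base _ n exactly when m ≠ n, and these left parts have pairwise distinct follower sets.
module Submission where

open import Defs
open import Data.Bool using (Bool; true; false; not; _∧_; if_then_else_)
open import Data.Bool.Properties using (∧-conicalˡ; not-injective)
open import Data.Empty using (⊥; ⊥-elim)
open import Data.Fin as Fin using (Fin; zero; suc; toℕ; punchIn; inject≤)
open import Data.Fin.Properties as FinP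
  using (0≢1+n; any?; punchIn-injective; punchInᵢ≢i; inject≤-injective; pigeonhole)
open import Data.Integer using (ℤ; +_; -[1+_]; -_)
  renaming (_+_ to _+ℤ_; _-_ to _-ℤ_; _*_ to _*ℤ_)
import Data.Integer.Properties as ℤ
import Data.Integer.Tactic.RingSolver as ℤSolver
open import Data.List using (List; []; _∷_; _++_; length; map; applyUpTo; concatMap; lookup; tabulate)
open import Data.List.Extrema.Nat using (max; xs≤max; ⊥≤max; argmax-sel)
open import Data.List.Membership.Propositional using (_∈_)
open import Data.List.Membership.Propositional.Properties
  using (∈-tabulate⁺; ∈-tabulate⁻; ∈-lookup; ∈-++⁺ˡ; ∈-++⁺ʳ; ∈-++⁻; ∈-map⁺; ∈-map⁻)
open import Data.List.Relation.Unary.All as All using (All; []; _∷_)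
import Data.List.Relation.Unary.All.Properties as AllP
open import Data.List.Relation.Unary.Any as Any using (here; there)
open import Data.List.Relation.Unary.Any.Properties using (lookup-index)
open import Data.List.Relation.Unary.AllPairs using (_∷_)
open import Data.List.Relation.Unary.Unique.Propositional using (Unique)
import Data.List.Relation.Unary.Unique.Propositional.Properties as UniqueP
open import Data.List.Properties
  using (∷-injectiveˡ; ∷-injectiveʳ; length-++; length-applyUpTo; map-upTo; concatMap-++; length-tabulate)
open import Data.Nat using (ℕ; zero; suc; _+_; _*_; _∸_; _^_; _≤_; _<_; z≤n; s≤s; z<s; s<s; _≟_)
import Data.Nat.Properties as ℕ
import Data.Nat.Tactic.RingSolver as ℕSolver
open import Data.List.Membership.DecPropositional _≟_ using (_∈?_)
open import Data.Product using (Σ-syntax; _×_; _,_; proj₁; proj₂)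
open import Data.Sum using (inj₁; inj₂; [_,_]′)
open import Data.Vec.Functional using (insertAt)
open import Data.Vec.Functional.Properties using (insertAt-lookup; insertAt-punchIn)
open import Function using (_∘_; id; _⇔_; mk⇔)
open import Function.Bundles using (Equivalence)
import Function.Properties.Equivalence as ⇔
open import Relation.Binary.PropositionalEquality
open ≡-Reasoning
open import Relation.Nullary using (¬_; Dec; yes; no; ¬?; does)
open import Relation.Nullary.Decidable using (dec-true; dec-false; does-⇔; decidable-stable)

-- Words and their occurrences

applyUpTo-++ : ∀ {A : Set} (f : ℕ → A) m n →
               applyUpTo f (m + n) ≡ applyUpTo f m ++ applyUpTo (λ k → f (m + k)) n
applyUpTo-++ f zero    n = refl
applyUpTo-++ f (suc m) n = cong (f 0 ∷_) (applyUpTo-++ (f ∘ suc) m n)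

applyUpTo-cong : ∀ {A : Set} {f g : ℕ → A} n → (∀ k → k < n → f k ≡ g k) →
                 applyUpTo f n ≡ applyUpTo g n
applyUpTo-cong zero    f≗g = refl
applyUpTo-cong (suc n) f≗g =
  cong₂ _∷_ (f≗g 0 z<s) (applyUpTo-cong n (λ k k<n → f≗g (suc k) (s<s k<n)))

applyUpTo-injective : ∀ {A : Set} {f g : ℕ → A} n → applyUpTo f n ≡ applyUpTo g n →
                      ∀ k → k < n → f k ≡ g k
applyUpTo-injective (suc n) eq zero    _         = ∷-injectiveˡ eq
applyUpTo-injective (suc n) eq (suc k) (s<s k<n) = applyUpTo-injective n (∷-injectiveʳ eq) k k<n

++-injective : ∀ {A : Set} (u u′ : List A) {w w′ : List A} →
               length u ≡ length u′ → u ++ w ≡ u′ ++ w′ → u ≡ u′ × w ≡ w′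
++-injective []      []        _   eq = refl , eq
++-injective (x ∷ u) (x′ ∷ u′) len eq
  with u≡u′ , w≡w′ ← ++-injective u u′ (ℕ.suc-injective len) (∷-injectiveʳ eq)
  = cong₂ _∷_ (∷-injectiveˡ eq) u≡u′ , w≡w′

readAt : Seq → ℤ → ℕ → Word
readAt S i n = applyUpTo (λ k → S (i +ℤ + k)) n

occursIn⇒readAt : ∀ {w S} → OccursIn w S → Σ[ i ∈ ℤ ] w ≡ readAt S i (length w)
occursIn⇒readAt {S = S} (i , eq) = i , trans eq (map-upTo (λ k → S (i +ℤ + k)) _)

readAt⇒occursIn : ∀ {w} S i → w ≡ readAt S i (length w) → OccursIn w S
readAt⇒occursIn S i eq = i , trans eq (sym (map-upTo (λ k → S (i +ℤ + k)) _))

occursIn-++ : ∀ u {w} S → OccursIn (u ++ w) S → OccursIn u S × OccursIn w S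
occursIn-++ u {w} S occ
  with i , eq ← occursIn⇒readAt {S = S} occ
  with u≡ , w≡ ← ++-injective u (readAt S i (length u)) (sym (length-applyUpTo _ (length u)))
                   (begin
                     u ++ w                                   ≡⟨ eq ⟩
                     readAt S i (length (u ++ w))             ≡⟨ cong (readAt S i) (length-++ u) ⟩
                     readAt S i (length u + length w)         ≡⟨ applyUpTo-++ _ (length u) (length w) ⟩
                     readAt S i (length u) ++ applyUpTo (λ k → S (i +ℤ + (length u + k))) (length w) ∎)
  = readAt⇒occursIn S i u≡
  , readAt⇒occursIn S (i +ℤ + length u)
      (trans w≡ (applyUpTo-cong (length w) λ k _ → cong S (shift k)))
  where
  shift : ∀ k → i +ℤ + (length u + k) ≡ (i +ℤ + length u) +ℤ + k
  shift k = trans (cong (i +ℤ_) (ℤ.pos-+ (length u) k)) (sym (ℤ.+-assoc i (+ length u) (+ k)))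

extend : (ℕ → Bool) → Seq
extend F (+ k)     = F k
extend F -[1+ k ] = false

occursIn-extend : ∀ F n → OccursIn (applyUpTo F n) (extend F)
occursIn-extend F n = readAt⇒occursIn (extend F) (+ 0) (cong (applyUpTo F) (sym (length-applyUpTo F n)))

occursIn⇒agree : ∀ {F n S} → OccursIn (applyUpTo F n) S →
                 Σ[ i ∈ ℤ ] (∀ k → k < n → S (i +ℤ + k) ≡ F k)
occursIn⇒agree {F} {n} {S} occ with i , eq ← occursIn⇒readAt {S = S} occ =
  i , λ k k<n → sym (applyUpTo-injective n
                       (trans eq (cong (readAt S i) (length-applyUpTo F n))) k k<n)

-- The blow-up 1 ↦ 110, 0 ↦ 000

blowUp : (ℕ → Bool) → ℕ → Bool
blowUp F 0                     = F 0
blowUp F 1                     = F 0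
blowUp F 2                     = false
blowUp F (suc (suc (suc k)))   = blowUp (F ∘ suc) k

blowUp^ : ℕ → (ℕ → Bool) → ℕ → Bool
blowUp^ zero    F = F
blowUp^ (suc N) F = blowUp (blowUp^ N F)

blowUpWord : Word → Word
blowUpWord = concatMap λ b → b ∷ b ∷ false ∷ []

blowUpWord^ : ℕ → Word → Word
blowUpWord^ zero    w = w
blowUpWord^ (suc N) w = blowUpWord (blowUpWord^ N w)

blowUpWord^-++ : ∀ N u w → blowUpWord^ N (u ++ w) ≡ blowUpWord^ N u ++ blowUpWord^ N w
blowUpWord^-++ zero    u w = refl
blowUpWord^-++ (suc N) u w =
  trans (cong blowUpWord (blowUpWord^-++ N u w)) (concatMap-++ _ (blowUpWord^ N u) (blowUpWord^ N w))

*3^-suc : ∀ n N → n * 3 ^ suc N ≡ n * 3 ^ N * 3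
*3^-suc n N = trans (cong (n *_) (ℕ.*-comm 3 (3 ^ N))) (sym (ℕ.*-assoc n (3 ^ N) 3))

window-blowUp : ∀ F h → applyUpTo (blowUp F) (h * 3) ≡ blowUpWord (applyUpTo F h)
window-blowUp F zero    = refl
window-blowUp F (suc h) = cong (λ w → F 0 ∷ F 0 ∷ false ∷ w) (window-blowUp (F ∘ suc) h)

window-blowUp^ : ∀ N F h → applyUpTo (blowUp^ N F) (h * 3 ^ N) ≡ blowUpWord^ N (applyUpTo F h)
window-blowUp^ zero    F h = cong (applyUpTo F) (ℕ.*-identityʳ h)
window-blowUp^ (suc N) F h = begin
  applyUpTo (blowUp^ (suc N) F) (h * 3 ^ suc N)     ≡⟨ cong (applyUpTo _) (*3^-suc h N) ⟩
  applyUpTo (blowUp (blowUp^ N F)) (h * 3 ^ N * 3)  ≡⟨ window-blowUp (blowUp^ N F) (h * 3 ^ N) ⟩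
  blowUpWord (applyUpTo (blowUp^ N F) (h * 3 ^ N))  ≡⟨ cong blowUpWord (window-blowUp^ N F h) ⟩
  blowUpWord^ (suc N) (applyUpTo F h)               ∎

blowUp-shift : ∀ F q k → blowUp F (q * 3 + k) ≡ blowUp (λ i → F (q + i)) k
blowUp-shift F zero    k = refl
blowUp-shift F (suc q) k = blowUp-shift (F ∘ suc) q k

copies : Fin 3 → Bool
copies zero             = true
copies (suc zero)       = true
copies (suc (suc zero)) = false

blowUp-digit : ∀ F q r → blowUp F (q * 3 + toℕ r) ≡ copies r ∧ F q
blowUp-digit F q r = trans (blowUp-shift F q (toℕ r)) (digit r)
  where
  digit : ∀ r → blowUp (λ i → F (q + i)) (toℕ r) ≡ copies r ∧ F q
  digit zero             = cong F (ℕ.+-identityʳ q)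
  digit (suc zero)       = cong F (ℕ.+-identityʳ q)
  digit (suc (suc zero)) = refl

extend-blowUp-digit : ∀ F {z} s r → z ≡ s *ℤ + 3 +ℤ + toℕ r → extend (blowUp F) z ≡ copies r ∧ extend F s
extend-blowUp-digit F (+ q) r refl = trans (cong (extend (blowUp F)) (sym pos-digits)) (blowUp-digit F q r)
  where
  pos-digits : + (q * 3 + toℕ r) ≡ + q *ℤ + 3 +ℤ + toℕ r
  pos-digits = trans (ℤ.pos-+ (q * 3) (toℕ r)) (cong (_+ℤ + toℕ r) (ℤ.pos-* q 3))
extend-blowUp-digit F -[1+ q ] zero             refl = refl
extend-blowUp-digit F -[1+ q ] (suc zero)       refl = refl
extend-blowUp-digit F -[1+ q ] (suc (suc zero)) refl = refl

-- Pointed shattering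

-- The offsets D realise every pattern just behind a 1 of S.  A shattered set of size k + 1
-- with maximum M gives this for the offsets M - b of its other elements b, and conversely.
PointedShattering : Seq → ℕ → Set
PointedShattering S k =
  Σ[ D ∈ (Fin k → ℕ) ] ((v : Fin k → Bool) →
    Σ[ p ∈ ℤ ] S p ≡ true × (∀ j → S (p -ℤ + D j) ≡ v j))

pos-∸ : ∀ {m n} → n ≤ m → + (m ∸ n) ≡ + m -ℤ + n
pos-∸ {m} {n} n≤m = sym (trans (ℤ.m-n≡m⊖n m n) (ℤ.⊖-≥ n≤m))

+-∸-assocℤ : ∀ i {m n} → n ≤ m → (i +ℤ + m) -ℤ + n ≡ i +ℤ + (m ∸ n)
+-∸-assocℤ i {m} {n} n≤m = trans (rearrange i (+ m) (+ n)) (cong (i +ℤ_) (sym (pos-∸ n≤m)))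
  where
  rearrange : ∀ i m n → (i +ℤ m) -ℤ n ≡ i +ℤ (m -ℤ n)
  rearrange = ℤSolver.solve-∀

+-∸-cancelℤ : ∀ i {m n} → n ≤ m → (i +ℤ + m) -ℤ + (m ∸ n) ≡ i +ℤ + n
+-∸-cancelℤ i {m} {n} n≤m = trans (cong (λ d → (i +ℤ + m) -ℤ d) (pos-∸ n≤m)) (cancel i (+ m) (+ n))
  where
  cancel : ∀ i m n → (i +ℤ m) -ℤ (m -ℤ n) ≡ i +ℤ n
  cancel = ℤSolver.solve-∀

-∸-cancelℤ : ∀ p {m n} → n ≤ m → (p -ℤ + m) +ℤ + (m ∸ n) ≡ p -ℤ + n
-∸-cancelℤ p {m} {n} n≤m = trans (cong ((p -ℤ + m) +ℤ_) (pos-∸ n≤m)) (telescope p (+ m) (+ n))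
  where
  telescope : ∀ p m n → (p -ℤ m) +ℤ (m -ℤ n) ≡ p -ℤ n
  telescope = ℤSolver.solve-∀

true≢false : true ≢ false
true≢false ()

≡true-injective : ∀ {x y} → (x ≡ true → y ≡ true) → (y ≡ true → x ≡ true) → x ≡ y
≡true-injective {true}          x⇒y _   = sym (x⇒y refl)
≡true-injective {false} {true}  _   y⇒x = y⇒x refl
≡true-injective {false} {false} _   _   = refl

lookup-injective : ∀ {xs : List ℕ} → Unique xs → ∀ {i j} → lookup xs i ≡ lookup xs j → i ≡ j
lookup-injective (_  ∷ _) {zero}  {zero}  _  = refl
lookup-injective (x∉ ∷ _) {zero}  {suc j} eq = ⊥-elim (All.lookup x∉ (∈-lookup j) eq)
lookup-injective (x∉ ∷ _) {suc i} {zero}  eq = ⊥-elim (All.lookup x∉ (∈-lookup i) (sym eq))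
lookup-injective (_  ∷ u) {suc i} {suc j} eq = cong suc (lookup-injective u eq)

assign : ∀ {k} → (Fin k → ℕ) → (Fin k → Bool) → ℕ → Bool
assign {zero}  b v y = false
assign {suc k} b v y = if does (b zero ≟ y) then v zero else assign (b ∘ suc) (v ∘ suc) y

assign-at : ∀ {k} (b : Fin k → ℕ) v → (∀ {i j} → b i ≡ b j → i ≡ j) → ∀ j → assign b v (b j) ≡ v j
assign-at b v b-inj zero rewrite dec-true (b zero ≟ b zero) refl = refl
assign-at b v b-inj (suc j) rewrite dec-false (b zero ≟ b (suc j)) (0≢1+n ∘ b-inj) =
  assign-at (b ∘ suc) (v ∘ suc) (FinP.suc-injective ∘ b-inj) j

shattered⇒pointed : ∀ {S B} k → Unique B → Shattered S B → suc k ≤ length B → PointedShattering S k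
shattered⇒pointed {S} {x ∷ xs} k unique shatter (s≤s k≤) = D , realise
  where
  B : List ℕ
  B = x ∷ xs

  M : ℕ
  M = max x xs

  M∈B : M ∈ B
  M∈B = [ here , there ]′ (argmax-sel id x xs)

  B≤M : All (_≤ M) B
  B≤M = ⊥≤max x xs ∷ xs≤max x xs

  iM : Fin (length B)
  iM = Any.index M∈B

  position : Fin k → Fin (length B)
  position j = punchIn iM (inject≤ j k≤)

  b : Fin k → ℕ
  b j = lookup B (position j)

  b-injective : ∀ {i j} → b i ≡ b j → i ≡ j
  b-injective = inject≤-injective k≤ k≤ _ _ ∘ punchIn-injective iM _ _ ∘ lookup-injective unique

  b≢M : ∀ j → b j ≢ M
  b≢M j bj≡M = punchInᵢ≢i iM _ (lookup-injective unique (trans bj≡M (lookup-index M∈B)))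

  D : Fin k → ℕ
  D j = M ∸ b j

  target : (Fin k → Bool) → ℕ → Bool
  target v y = if does (y ≟ M) then true else assign b v y

  realise : (v : Fin k → Bool) → Σ[ p ∈ ℤ ] S p ≡ true × (∀ j → S (p -ℤ + D j) ≡ v j)
  realise v with i , L , cut ← shatter (target v) = i +ℤ + M , proj₂ M-in , reads
    where
    M-in : InN S i L M
    M-in = Equivalence.from (cut M M∈B) (cong (if_then true else assign b v M) (dec-true (M ≟ M) refl))

    target-b : ∀ j → target v (b j) ≡ v j
    target-b j rewrite dec-false (b j ≟ M) (b≢M j) = assign-at b v b-injective j

    b-in : ∀ j → b j ∈ B
    b-in j = ∈-lookup (position j)

    reads : ∀ j → S ((i +ℤ + M) -ℤ + D j) ≡ v j
    reads j = begin
      S ((i +ℤ + M) -ℤ + D j)   ≡⟨ cong S (+-∸-cancelℤ i (All.lookup B≤M (b-in j))) ⟩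
      S (i +ℤ + b j)            ≡⟨ ≡true-injective to from ⟩
      target v (b j)            ≡⟨ target-b j ⟩
      v j                       ∎
      where
      to : S (i +ℤ + b j) ≡ true → target v (b j) ≡ true
      to S≡ = Equivalence.to (cut (b j) (b-in j))
                (ℕ.≤-<-trans (All.lookup B≤M (b-in j)) (proj₁ M-in) , S≡)
      from : target v (b j) ≡ true → S (i +ℤ + b j) ≡ true
      from = proj₂ ∘ Equivalence.from (cut (b j) (b-in j))

offsets-positive : ∀ {S k} (ps : PointedShattering S k) j → 0 < proj₁ ps j
offsets-positive {S} (D , realise) j with p , Sp , reads ← realise (λ _ → false) = ℕ.n≢0⇒n>0 λ Dj≡0 →
  true≢false (begin
    true                ≡⟨ sym Sp ⟩
    S p                 ≡⟨ cong S (sym (ℤ.+-identityʳ p)) ⟩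
    S (p -ℤ + 0)        ≡⟨ cong (λ d → S (p -ℤ + d)) (sym Dj≡0) ⟩
    S (p -ℤ + D j)      ≡⟨ reads j ⟩
    false               ∎)

pointed⇒¬VCAtMost : ∀ {S k} → PointedShattering S k → ¬ VCAtMost k S
pointed⇒¬VCAtMost {S} {k} ps@(D , realise) vc = ℕ.<-irrefl refl (subst (_≤ k) |B| (vc B unique shattered))
  where
  offset-injective : ∀ {i j} → D i ≡ D j → i ≡ j
  offset-injective {i} {j} Di≡Dj = decidable-stable (i Fin.≟ j) λ i≢j →
    let p , _ , reads = realise (λ l → does (l Fin.≟ i)) in
    true≢false (begin
      true                      ≡⟨ sym (dec-true (i Fin.≟ i) refl) ⟩
      does (i Fin.≟ i)          ≡⟨ sym (reads i) ⟩
      S (p -ℤ + D i)            ≡⟨ cong (λ d → S (p -ℤ + d)) Di≡Dj ⟩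
      S (p -ℤ + D j)            ≡⟨ reads j ⟩
      does (j Fin.≟ i)          ≡⟨ dec-false (j Fin.≟ i) (i≢j ∘ sym) ⟩
      false                     ∎)

  M : ℕ
  M = max 0 (tabulate D)

  D≤M : ∀ j → D j ≤ M
  D≤M j = All.lookup (xs≤max 0 (tabulate D)) (∈-tabulate⁺ j)

  b : Fin k → ℕ
  b j = M ∸ D j

  b<M : ∀ j → b j < M
  b<M j = ℕ.∸-monoʳ-< (offsets-positive ps j) (D≤M j)

  B : List ℕ
  B = M ∷ tabulate b

  |B| : length B ≡ suc k
  |B| = cong suc (length-tabulate b)

  unique : Unique B
  unique = AllP.tabulate⁺ (λ j M≡bj → ℕ.<-irrefl (sym M≡bj) (b<M j))
         ∷ UniqueP.tabulate⁺ (offset-injective ∘ ℕ.∸-cancelˡ-≡ (D≤M _) (D≤M _))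

  shattered : Shattered S B
  shattered f with p , Sp , reads ← realise (f ∘ b) = i , L , membership
    where
    i : ℤ
    i = p -ℤ + M
    L : ℕ
    L = if f M then suc M else M
    M≤L : M ≤ L
    M≤L with f M
    ... | true  = ℕ.n≤1+n M
    ... | false = ℕ.≤-refl
    at-M : S (i +ℤ + M) ≡ true
    at-M = trans (cong S (cancel p (+ M))) Sp
      where
      cancel : ∀ p m → (p -ℤ m) +ℤ m ≡ p
      cancel = ℤSolver.solve-∀
    membership : ∀ c → c ∈ B → InN S i L c ⇔ (f c ≡ true)
    membership c (here refl) with f M
    ... | true  = mk⇔ (λ _ → refl) (λ _ → ℕ.n<1+n M , at-M)
    ... | false = mk⇔ (λ (M<M , _) → ⊥-elim (ℕ.<-irrefl refl M<M)) (λ ())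
    membership c (there c∈) with j , refl ← ∈-tabulate⁻ c∈ =
      mk⇔ (λ (_ , S≡) → trans (sym at-b) S≡) (λ fbj → ℕ.<-≤-trans (b<M j) M≤L , trans at-b fbj)
      where
      at-b : S (i +ℤ + b j) ≡ f (b j)
      at-b = trans (cong S (-∸-cancelℤ p (D≤M j))) (reads j)

-- pos realises v inside the window [0, len); pos > 0 lets a blow-up read the 0 ending the block before.
record RealisedWithin (F : ℕ → Bool) {k : ℕ} (D : Fin k → ℕ) (len : ℕ) (v : Fin k → Bool) : Set where
  constructor realised
  field
    pos       : ℕ
    pos<len   : pos < len
    pos>0     : 0 < pos
    D≤pos     : ∀ j → D j ≤ pos
    one-at    : F pos ≡ true
    reads     : ∀ j → F (pos ∸ D j) ≡ v j

PointedWithin : (ℕ → Bool) → ℕ → ℕ → Set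
PointedWithin F k len = Σ[ D ∈ (Fin k → ℕ) ] ((v : Fin k → Bool) → RealisedWithin F D len v)

pointedWithin⇒pointed : ∀ {F k len S} → PointedWithin F k len → OccursIn (applyUpTo F len) S →
                        PointedShattering S k
pointedWithin⇒pointed {F} {S = S} (D , realise) occ with i , agree ← occursIn⇒agree {S = S} occ =
  D , λ v → let open RealisedWithin (realise v) in
    i +ℤ + pos , trans (agree pos pos<len) one-at , λ j → begin
      S ((i +ℤ + pos) -ℤ + D j)   ≡⟨ cong S (+-∸-assocℤ i (D≤pos j)) ⟩
      S (i +ℤ + (pos ∸ D j))      ≡⟨ agree (pos ∸ D j) (ℕ.≤-<-trans (ℕ.m∸n≤m pos (D j)) pos<len) ⟩
      F (pos ∸ D j)               ≡⟨ reads j ⟩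
      v j                         ∎

blowUp-before-block : ∀ F p → 0 < p → blowUp F (p * 3 + 0 ∸ 1) ≡ false
blowUp-before-block F (suc q) _ = trans (cong (blowUp F) (last-of-block q)) (blowUp-digit F q (suc (suc zero)))
  where
  last-of-block : ∀ q → suc (suc (q * 3 + 0)) ≡ q * 3 + 2
  last-of-block = ℕSolver.solve-∀

bit : Bool → Fin 3
bit false = zero
bit true  = suc zero

-- A new first offset 1 reads off the digit inside the block, the old offsets are tripled.
blowUp-pointedWithin : ∀ {F k len} → PointedWithin F k len → PointedWithin (blowUp F) (suc k) (len * 3)
blowUp-pointedWithin {F} {k} {len} (D , realise) = D′ , realise′
  where
  D′ : Fin (suc k) → ℕ
  D′ zero    = 1
  D′ (suc j) = D j * 3

  realise′ : (v : Fin (suc k) → Bool) → RealisedWithin (blowUp F) D′ (len * 3) v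
  realise′ v = record
    { pos     = y
    ; pos<len = ℕ.<-≤-trans (ℕ.+-monoʳ-< (p * 3) (bit<3 e))
                  (subst (_≤ len * 3) (ℕ.+-comm 3 (p * 3)) (ℕ.*-monoˡ-≤ 3 pos<len))
    ; pos>0   = ℕ.<-≤-trans (ℕ.*-monoˡ-< 3 pos>0) (ℕ.m≤m+n (p * 3) _)
    ; D≤pos   = λ { zero → ℕ.<-≤-trans (ℕ.*-monoˡ-< 3 pos>0) (ℕ.m≤m+n (p * 3) _)
                  ; (suc j) → ℕ.≤-trans (ℕ.*-monoˡ-≤ 3 (D≤pos j)) (ℕ.m≤m+n (p * 3) _) }
    ; one-at  = trans (blowUp-digit F p (bit e)) (copies-bit e one-at)
    ; reads   = reads′
    }
    where
    e : Bool
    e = v zero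
    open RealisedWithin (realise (v ∘ suc))
    p = pos
    y : ℕ
    y = p * 3 + toℕ (bit e)

    bit<3 : ∀ e → toℕ (bit e) < 3
    bit<3 false = z<s
    bit<3 true  = s<s z<s

    copies-bit : ∀ e {b} → b ≡ true → copies (bit e) ∧ b ≡ true
    copies-bit false refl = refl
    copies-bit true  refl = refl

    reads-digit : ∀ e → blowUp F (p * 3 + toℕ (bit e) ∸ 1) ≡ e
    reads-digit true  = begin
      blowUp F (p * 3 + 1 ∸ 1)   ≡⟨ cong (blowUp F) (trans (ℕ.m+n∸n≡m (p * 3) 1) (sym (ℕ.+-identityʳ _))) ⟩
      blowUp F (p * 3 + 0)       ≡⟨ blowUp-digit F p zero ⟩
      F p                        ≡⟨ one-at ⟩
      true                       ∎
    reads-digit false = blowUp-before-block F p pos>0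

    reads′ : ∀ j → blowUp F (y ∸ D′ j) ≡ v j
    reads′ zero    = reads-digit e
    reads′ (suc j) = begin
      blowUp F (p * 3 + toℕ (bit e) ∸ D j * 3)   ≡⟨ cong (blowUp F) block-back ⟩
      blowUp F ((p ∸ D j) * 3 + toℕ (bit e))     ≡⟨ blowUp-digit F (p ∸ D j) (bit e) ⟩
      copies (bit e) ∧ F (p ∸ D j)               ≡⟨ copies-bit′ e (reads j) ⟩
      v (suc j)                                  ∎
      where
      block-back : p * 3 + toℕ (bit e) ∸ D j * 3 ≡ (p ∸ D j) * 3 + toℕ (bit e)
      block-back = trans (ℕ.+-∸-comm _ (ℕ.*-monoˡ-≤ 3 (D≤pos j)))
                         (cong (_+ toℕ (bit e)) (sym (ℕ.*-distribʳ-∸ 3 p (D j))))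
      copies-bit′ : ∀ e {b c} → b ≡ c → copies (bit e) ∧ b ≡ c
      copies-bit′ false refl = refl
      copies-bit′ true  refl = refl

blowUp^-pointedWithin : ∀ N {F k len} → PointedWithin F k len →
                        PointedWithin (blowUp^ N F) (N + k) (len * 3 ^ N)
blowUp^-pointedWithin zero    {F} {k} {len} pw = subst (PointedWithin F k) (sym (ℕ.*-identityʳ len)) pw
blowUp^-pointedWithin (suc N) {len = len}   pw =
  subst (PointedWithin _ _) (sym (*3^-suc len N)) (blowUp-pointedWithin (blowUp^-pointedWithin N pw))

blowUp-one : ∀ F k → blowUp F k ≡ true → Σ[ q ∈ ℕ ] Σ[ e ∈ Bool ] k ≡ q * 3 + toℕ (bit e) × F q ≡ true
blowUp-one F 0                   F0≡ = 0 , false , refl , F0≡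
blowUp-one F 1                   F0≡ = 0 , true  , refl , F0≡
blowUp-one F (suc (suc (suc k))) one with q , e , refl , Fq ← blowUp-one (F ∘ suc) k one =
  suc q , e , refl , Fq

extend-blowUp-one : ∀ F y → extend (blowUp F) y ≡ true →
                    Σ[ x ∈ ℤ ] Σ[ e ∈ Bool ] y ≡ x *ℤ + 3 +ℤ + toℕ (bit e) × extend F x ≡ true
extend-blowUp-one F (+ k) one with q , e , refl , Fq ← blowUp-one F k one =
  + q , e , trans (ℤ.pos-+ (q * 3) _) (cong (_+ℤ + toℕ (bit e)) (ℤ.pos-* q 3)) , Fq

-- offsets are written 3δ + t with a balanced ternary digit t
data Trit : Set where
  t⁻ t⁰ t⁺ : Trit

⟦_⟧ : Trit → ℤ
⟦ t⁻ ⟧ = - + 1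
⟦ t⁰ ⟧ = + 0
⟦ t⁺ ⟧ = + 1

_≟t⁰ : (t : Trit) → Dec (t ≡ t⁰)
t⁻ ≟t⁰ = no λ ()
t⁰ ≟t⁰ = yes refl
t⁺ ≟t⁰ = no λ ()

balanced : ∀ D → Σ[ δ ∈ ℕ ] Σ[ t ∈ Trit ] + D ≡ + δ *ℤ + 3 +ℤ ⟦ t ⟧
balanced zero    = 0 , t⁰ , refl
balanced (suc D) with δ , t , eq ← balanced D = carry δ t (cong (+ 1 +ℤ_) eq)
  where
  carry : ∀ δ t → + suc D ≡ + 1 +ℤ (+ δ *ℤ + 3 +ℤ ⟦ t ⟧) →
          Σ[ δ ∈ ℕ ] Σ[ t ∈ Trit ] + suc D ≡ + δ *ℤ + 3 +ℤ ⟦ t ⟧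
  carry δ t⁻ eq = δ , t⁰ , trans eq (lemma (+ δ))
    where
    lemma : ∀ x → + 1 +ℤ (x *ℤ + 3 +ℤ - + 1) ≡ x *ℤ + 3 +ℤ + 0
    lemma = ℤSolver.solve-∀
  carry δ t⁰ eq = δ , t⁺ , trans eq (lemma (+ δ))
    where
    lemma : ∀ x → + 1 +ℤ (x *ℤ + 3 +ℤ + 0) ≡ x *ℤ + 3 +ℤ + 1
    lemma = ℤSolver.solve-∀
  carry δ t⁺ eq = suc δ , t⁻ , trans eq (lemma (+ δ))
    where
    lemma : ∀ x → + 1 +ℤ (x *ℤ + 3 +ℤ + 1) ≡ (+ 1 +ℤ x) *ℤ + 3 +ℤ - + 1
    lemma = ℤSolver.solve-∀

sees : Trit → Bool → Bool
sees t⁻ e = not e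
sees t⁰ e = true
sees t⁺ e = e

sees-unique : ∀ t {e e′} → t ≢ t⁰ → sees t e ≡ true → sees t e′ ≡ true → e ≡ e′
sees-unique t⁻ _ e≡ e′≡ = not-injective (trans e≡ (sym e′≡))
sees-unique t⁰ t≢ _ _   = ⊥-elim (t≢ refl)
sees-unique t⁺ _ e≡ e′≡ = trans e≡ (sym e′≡)

blowUp-read-behind : ∀ F x e δ t → extend (blowUp F) ((x *ℤ + 3 +ℤ + toℕ (bit e)) -ℤ (+ δ *ℤ + 3 +ℤ ⟦ t ⟧))
                                    ≡ sees t e ∧ extend F (x -ℤ + δ)
blowUp-read-behind F x false δ t⁻ = extend-blowUp-digit F (x -ℤ + δ) (suc zero) (lemma x (+ δ))
  where
  lemma : ∀ x d → (x *ℤ + 3 +ℤ + 0) -ℤ (d *ℤ + 3 +ℤ - + 1) ≡ (x -ℤ d) *ℤ + 3 +ℤ + 1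
  lemma = ℤSolver.solve-∀
blowUp-read-behind F x false δ t⁰ = extend-blowUp-digit F (x -ℤ + δ) zero (lemma x (+ δ))
  where
  lemma : ∀ x d → (x *ℤ + 3 +ℤ + 0) -ℤ (d *ℤ + 3 +ℤ + 0) ≡ (x -ℤ d) *ℤ + 3 +ℤ + 0
  lemma = ℤSolver.solve-∀
blowUp-read-behind F x false δ t⁺ = extend-blowUp-digit F (x -ℤ + δ -ℤ + 1) (suc (suc zero)) (lemma x (+ δ))
  where
  lemma : ∀ x d → (x *ℤ + 3 +ℤ + 0) -ℤ (d *ℤ + 3 +ℤ + 1) ≡ (x -ℤ d -ℤ + 1) *ℤ + 3 +ℤ + 2
  lemma = ℤSolver.solve-∀
blowUp-read-behind F x true δ t⁻ = extend-blowUp-digit F (x -ℤ + δ) (suc (suc zero)) (lemma x (+ δ))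
  where
  lemma : ∀ x d → (x *ℤ + 3 +ℤ + 1) -ℤ (d *ℤ + 3 +ℤ - + 1) ≡ (x -ℤ d) *ℤ + 3 +ℤ + 2
  lemma = ℤSolver.solve-∀
blowUp-read-behind F x true δ t⁰ = extend-blowUp-digit F (x -ℤ + δ) (suc zero) (lemma x (+ δ))
  where
  lemma : ∀ x d → (x *ℤ + 3 +ℤ + 1) -ℤ (d *ℤ + 3 +ℤ + 0) ≡ (x -ℤ d) *ℤ + 3 +ℤ + 1
  lemma = ℤSolver.solve-∀
blowUp-read-behind F x true δ t⁺ = extend-blowUp-digit F (x -ℤ + δ) zero (lemma x (+ δ))
  where
  lemma : ∀ x d → (x *ℤ + 3 +ℤ + 1) -ℤ (d *ℤ + 3 +ℤ + 1) ≡ (x -ℤ d) *ℤ + 3 +ℤ + 0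
  lemma = ℤSolver.solve-∀

-- Behind a 1 of a blow-up, an offset whose digit t is nonzero tells whether the 1 sits at
-- the first or second place of its block; once that is fixed, every offset reads the source.
blowUp-pointed : ∀ {F k} → PointedShattering (extend (blowUp F)) (suc k) → PointedShattering (extend F) k
blowUp-pointed {F} {k} (D , realise) = δ ∘ punchIn j* , realise′
  where
  δ : Fin (suc k) → ℕ
  δ j = proj₁ (balanced (D j))

  t : Fin (suc k) → Trit
  t j = proj₁ (proj₂ (balanced (D j)))

  source : ∀ v → Σ[ x ∈ ℤ ] Σ[ e ∈ Bool ]
             extend F x ≡ true × (∀ j → sees (t j) e ∧ extend F (x -ℤ + δ j) ≡ v j)
  source v with p , one , reads ← realise v with x , e , refl , Fx ← extend-blowUp-one F p one =
    x , e , Fx , λ j → begin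
      sees (t j) e ∧ extend F (x -ℤ + δ j)
        ≡⟨ blowUp-read-behind F x e (δ j) (t j) ⟨
      extend (blowUp F) (p -ℤ (+ δ j *ℤ + 3 +ℤ ⟦ t j ⟧))
        ≡⟨ cong (λ d → extend (blowUp F) (p -ℤ d)) (proj₂ (proj₂ (balanced (D j)))) ⟨
      extend (blowUp F) (p -ℤ + D j)
        ≡⟨ reads j ⟩
      v j
        ∎

  e₁ : Bool
  e₁ = proj₁ (proj₂ (source (λ _ → true)))

  sees-e₁ : ∀ j → sees (t j) e₁ ≡ true
  sees-e₁ j = ∧-conicalˡ _ _ (proj₂ (proj₂ (proj₂ (source (λ _ → true)))) j)

  choice : Σ[ j* ∈ Fin (suc k) ] (∀ e → sees (t j*) e ≡ true → ∀ i → sees (t i) e ≡ true)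
  choice with any? (λ j → ¬? (t j ≟t⁰))
  ... | yes (j* , t≢t⁰) = j* , λ e seen i →
          subst (λ e → sees (t i) e ≡ true) (sees-unique (t j*) t≢t⁰ (sees-e₁ j*) seen) (sees-e₁ i)
  ... | no none = zero , λ e _ i →
          subst (λ t → sees t e ≡ true) (sym (decidable-stable (t i ≟t⁰) (none ∘ (i ,_)))) refl

  j* : Fin (suc k)
  j* = proj₁ choice

  realise′ : (v : Fin k → Bool) →
             Σ[ x ∈ ℤ ] extend F x ≡ true × (∀ i → extend F (x -ℤ + δ (punchIn j* i)) ≡ v i)
  realise′ v with x , e , Fx , reads ← source (insertAt v j* true) = x , Fx , λ i → begin
      extend F (x -ℤ + δ (punchIn j* i))                          ≡⟨ cong (_∧ _) (all-seen (punchIn j* i)) ⟨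
      sees (t (punchIn j* i)) e ∧ extend F (x -ℤ + δ (punchIn j* i)) ≡⟨ reads (punchIn j* i) ⟩
      insertAt v j* true (punchIn j* i)                           ≡⟨ insertAt-punchIn v j* true i ⟩
      v i                                                         ∎
    where
    all-seen : ∀ i → sees (t i) e ≡ true
    all-seen = proj₂ choice e (∧-conicalˡ _ _ (trans (reads j*) (insertAt-lookup v j* true)))

blowUp^-pointed : ∀ N {F k} → PointedShattering (extend (blowUp^ N F)) (N + k) →
                  PointedShattering (extend F) k
blowUp^-pointed zero    = id
blowUp^-pointed (suc N) = blowUp^-pointed N ∘ blowUp-pointed

-- The base sequences

≤⇒≢+ : ∀ {x y d} → x ≤ y → 0 < d → x ≢ y + d
≤⇒≢+ {y = y} x≤y d>0 x≡ = ℕ.<-irrefl x≡ (ℕ.≤-<-trans x≤y (ℕ.m<m+n y d>0))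

data Point : Set where
  left right : Bool → Point

data Chord : Point → Point → Set where
  inner-left  : Chord (left true) (left false)
  inner-right : Chord (right true) (right false)
  across      : ∀ ε δ → Chord (right ε) (left δ)

module TwoPairs (u a v b : ℕ) where

  at : Point → ℕ
  at (left false)  = u
  at (left true)   = u + a
  at (right false) = v
  at (right true)  = v + b

  left≤ : ∀ δ → at (left δ) ≤ u + a
  left≤ false = ℕ.m≤m+n u a
  left≤ true  = ℕ.≤-refl

  ≤right : ∀ ε → v ≤ at (right ε)
  ≤right false = ℕ.≤-refl
  ≤right true  = ℕ.m≤m+n v b

  chord : u + a < v → ∀ x y {d} → 0 < d → at x ≡ at y + d → Chord x y
  chord _   (left false)  (left false)  d>0 eq = ⊥-elim (≤⇒≢+ ℕ.≤-refl d>0 eq)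
  chord _   (left false)  (left true)   d>0 eq = ⊥-elim (≤⇒≢+ (ℕ.m≤m+n u a) d>0 eq)
  chord _   (left true)   (left false)  _   _  = inner-left
  chord _   (left true)   (left true)   d>0 eq = ⊥-elim (≤⇒≢+ ℕ.≤-refl d>0 eq)
  chord sep (left δ)      (right ε)     d>0 eq =
    ⊥-elim (≤⇒≢+ (ℕ.≤-trans (left≤ δ) (ℕ.≤-trans (ℕ.<⇒≤ sep) (≤right ε))) d>0 eq)
  chord _   (right ε)     (left δ)      _   _  = across ε δ
  chord _   (right false) (right false) d>0 eq = ⊥-elim (≤⇒≢+ ℕ.≤-refl d>0 eq)
  chord _   (right false) (right true)  d>0 eq = ⊥-elim (≤⇒≢+ (ℕ.m≤m+n v b) d>0 eq)
  chord _   (right true)  (right false) _   _  = inner-right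
  chord _   (right true)  (right true)  d>0 eq = ⊥-elim (≤⇒≢+ ℕ.≤-refl d>0 eq)

  across-long : ∀ ε δ {d} → at (right ε) ≡ at (left δ) + d → v ≤ u + a + d
  across-long ε δ {d} eq = ℕ.≤-trans (≤right ε) (subst (_≤ u + a + d) (sym eq) (ℕ.+-monoˡ-≤ d (left≤ δ)))

  -- the difference (b or 0) of the upper points cannot be made up by the lower points
  no-step : a ≢ b → 0 < b → ∀ δ δ′ → at (left δ′) + b ≢ at (left δ)
  no-step _   b>0 false false eq = ≤⇒≢+ ℕ.≤-refl b>0 (sym eq)
  no-step a≢b _   true  false eq = a≢b (sym (ℕ.+-cancelˡ-≡ u b a eq))
  no-step _   b>0 false true  eq =
    ≤⇒≢+ ℕ.≤-refl (ℕ.<-≤-trans b>0 (ℕ.m≤n+m b a)) (sym (trans (sym (ℕ.+-assoc u a b)) eq))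
  no-step _   b>0 true  true  eq = ≤⇒≢+ ℕ.≤-refl b>0 (sym eq)

  across-top : a ≢ b → 0 < b → ∀ ε δ ε′ δ′ {d} →
               at (right ε) ≡ at (left δ) + d → at (right ε′) ≡ at (left δ′) + d → ε ≡ ε′
  across-top _   _   false _ false _  _  _  = refl
  across-top _   _   true  _ true  _  _  _  = refl
  across-top a≢b b>0 true  δ false δ′ {d} eq eq′ =
    ⊥-elim (no-step a≢b b>0 δ δ′ (ℕ.+-cancelʳ-≡ d _ _ (begin
    at (left δ′) + b + d     ≡⟨ swap (at (left δ′)) b d ⟩
    at (left δ′) + d + b     ≡⟨ cong (_+ b) eq′ ⟨
    v + b                    ≡⟨ eq ⟩
    at (left δ) + d          ∎)))
    where
    swap : ∀ x b d → x + b + d ≡ x + d + b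
    swap = ℕSolver.solve-∀
  across-top a≢b b>0 false δ true  δ′ eq eq′ = sym (across-top a≢b b>0 true δ′ false δ eq′ eq)

  top-unique : a ≢ b → 0 < b → u + a + a < v → u + a + b < v →
               ∀ {x y x′ y′ d} → 0 < d → at x ≡ at y + d → at x′ ≡ at y′ + d → x ≡ x′
  top-unique a≢b b>0 a-gap b-gap {x} {y} {x′} {y′} {d} d>0 eq eq′ =
    compare (chord sep x y d>0 eq) (chord sep x′ y′ d>0 eq′) eq eq′
    where
    sep : u + a < v
    sep = ℕ.≤-<-trans (ℕ.m≤m+n (u + a) a) a-gap

    d≡a : u + a ≡ u + d → d ≡ a
    d≡a eq = sym (ℕ.+-cancelˡ-≡ u a d eq)

    d≡b : v + b ≡ v + d → d ≡ b
    d≡b eq = sym (ℕ.+-cancelˡ-≡ v b d eq)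

    too-short : ∀ {c} → d ≡ c → u + a + c < v → v ≤ u + a + d → ⊥
    too-short d≡c gap long = ℕ.<⇒≱ gap (subst (λ e → v ≤ u + a + e) d≡c long)

    compare : ∀ {x y x′ y′} → Chord x y → Chord x′ y′ → at x ≡ at y + d → at x′ ≡ at y′ + d → x ≡ x′
    compare inner-left   inner-left     _  _   = refl
    compare inner-right  inner-right    _  _   = refl
    compare inner-left   inner-right    eq eq′ = ⊥-elim (a≢b (trans (sym (d≡a eq)) (d≡b eq′)))
    compare inner-right  inner-left     eq eq′ = ⊥-elim (a≢b (trans (sym (d≡a eq′)) (d≡b eq)))
    compare inner-left   (across ε δ)   eq eq′ = ⊥-elim (too-short (d≡a eq) a-gap (across-long ε δ eq′))
    compare (across ε δ) inner-left     eq eq′ = ⊥-elim (too-short (d≡a eq′) a-gap (across-long ε δ eq))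
    compare inner-right  (across ε δ)   eq eq′ = ⊥-elim (too-short (d≡b eq) b-gap (across-long ε δ eq′))
    compare (across ε δ) inner-right    eq eq′ = ⊥-elim (too-short (d≡b eq′) b-gap (across-long ε δ eq))
    compare (across ε δ) (across ε′ δ′) eq eq′ = cong right (across-top a≢b b>0 ε δ ε′ δ′ eq eq′)

indicator : List ℕ → ℕ → Bool
indicator xs q = does (q ∈? xs)

indicator-∈ : ∀ xs {q} → indicator xs q ≡ true → q ∈ xs
indicator-∈ xs {q} with q ∈? xs
... | yes q∈xs = λ _ → q∈xs
... | no  _    = λ ()

indicator-splice-below : ∀ {l q} xs ys → All (_< l) xs → q < l →
                         indicator (xs ++ map (_+_ l) ys) q ≡ indicator xs q
indicator-splice-below {l} {q} xs ys xs<l q<l = does-⇔ (mk⇔ to ∈-++⁺ˡ) (q ∈? _) (q ∈? xs)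
  where
  to : q ∈ xs ++ map (_+_ l) ys → q ∈ xs
  to q∈ with ∈-++⁻ xs q∈
  ... | inj₁ q∈xs = q∈xs
  ... | inj₂ q∈ys with y , _ , refl ← ∈-map⁻ (_+_ l) q∈ys = ⊥-elim (ℕ.m+n≮m l y q<l)

indicator-splice-above : ∀ {l} q xs ys → All (_< l) xs →
                         indicator (xs ++ map (_+_ l) ys) (l + q) ≡ indicator ys q
indicator-splice-above {l} q xs ys xs<l = does-⇔ (mk⇔ to (∈-++⁺ʳ xs ∘ ∈-map⁺ (_+_ l))) (l + q ∈? _) (q ∈? ys)
  where
  to : l + q ∈ xs ++ map (_+_ l) ys → q ∈ ys
  to l+q∈ with ∈-++⁻ xs l+q∈
  ... | inj₁ l+q∈xs = ⊥-elim (ℕ.m+n≮m l q (All.lookup xs<l l+q∈xs))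
  ... | inj₂ l+q∈ys with y , y∈ys , eq ← ∈-map⁻ (_+_ l) l+q∈ys =
    subst (_∈ ys) (sym (ℕ.+-cancelˡ-≡ l q y eq)) y∈ys

window-splice : ∀ {l} r xs ys → All (_< l) xs →
                applyUpTo (indicator (xs ++ map (_+_ l) ys)) (l + r)
                ≡ applyUpTo (indicator xs) l ++ applyUpTo (indicator ys) r
window-splice {l} r xs ys xs<l = trans (applyUpTo-++ _ l r)
  (cong₂ _++_ (applyUpTo-cong l λ q q<l → indicator-splice-below xs ys xs<l q<l)
              (applyUpTo-cong r λ q _   → indicator-splice-above q xs ys xs<l))

<-witness : ∀ {x y} k → y ≡ x + suc k → x < y
<-witness {x} k refl = ℕ.m<m+n x z<s

-- With a = 1 + m and b = 1 + n: 1s at the corner c = 3a + 2 and at c + a, and past the cut at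
-- c + 2a + 1, at distances b + 1 and 2b + 1 from it.  For m = n these are {c, 2c} + {0, a}.
corner : ℕ → ℕ
corner m = suc m * 3 + 2

cut : ℕ → ℕ
cut m = corner m + suc m * 2 + 1

leftOnes : ℕ → List ℕ
leftOnes m = corner m ∷ corner m + suc m ∷ []

rightOnes : ℕ → List ℕ
rightOnes n = suc (suc n) ∷ suc (suc n) + suc n ∷ []

rightLength : ℕ → ℕ
rightLength n = suc (suc n) + suc n + 1

base : ℕ → ℕ → ℕ → Bool
base m n = indicator (leftOnes m ++ map (_+_ (cut m)) (rightOnes n))

leftOnes<cut : ∀ m → All (_< cut m) (leftOnes m)
leftOnes<cut m = <-witness (suc m * 2) (lemma₁ m) ∷ <-witness (suc m) (lemma₂ m) ∷ []
  where
  lemma₁ : ∀ m → suc m * 3 + 2 + suc m * 2 + 1 ≡ suc m * 3 + 2 + suc (suc m * 2)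
  lemma₁ = ℕSolver.solve-∀
  lemma₂ : ∀ m → suc m * 3 + 2 + suc m * 2 + 1 ≡ suc m * 3 + 2 + suc m + suc (suc m)
  lemma₂ = ℕSolver.solve-∀

module BasePairs (m n : ℕ) = TwoPairs (corner m) (suc m) (cut m + suc (suc n)) (suc n)

base-one : ∀ m n {q} → base m n q ≡ true → Σ[ x ∈ Point ] q ≡ BasePairs.at m n x
base-one m n {q} one with indicator-∈ (leftOnes m ++ map (_+_ (cut m)) (rightOnes n)) {q} one
... | here refl                         = left false , refl
... | there (here refl)                 = left true , refl
... | there (there (here refl))         = right false , refl
... | there (there (there (here refl))) = right true , sym (ℕ.+-assoc (cut m) (suc (suc n)) (suc n))

extend-one : ∀ {F} z → extend F z ≡ true → Σ[ q ∈ ℕ ] z ≡ + q × F q ≡ true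
extend-one (+ q) Fq = q , refl , Fq

-ℤ≡⇒≡+ : ∀ {x y d} → + x -ℤ + d ≡ + y → x ≡ y + d
-ℤ≡⇒≡+ {x} {y} {d} eq = ℤ.+-injective (begin
  + x                   ≡⟨ cancel (+ x) (+ d) ⟨
  (+ x -ℤ + d) +ℤ + d   ≡⟨ cong (_+ℤ + d) eq ⟩
  + y +ℤ + d            ≡⟨ ℤ.pos-+ y d ⟨
  + (y + d)             ∎)
  where
  cancel : ∀ x d → (x -ℤ d) +ℤ d ≡ x
  cancel = ℤSolver.solve-∀

base-not-pointed : ∀ {m n} → m ≢ n → ¬ PointedShattering (extend (base m n)) 2
base-not-pointed {m} {n} m≢n ps@(D , realise) = true≢false (begin
  true                                      ≡⟨ reads₁ (suc zero) ⟨
  extend (base m n) (p₁ -ℤ + D (suc zero))  ≡⟨ cong (λ p → extend (base m n) (p -ℤ + D (suc zero))) same-place ⟩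
  extend (base m n) (p₂ -ℤ + D (suc zero))  ≡⟨ reads₂ (suc zero) ⟩
  false                                     ∎)
  where
  open BasePairs m n

  first : Fin 2 → Bool
  first zero    = true
  first (suc _) = false

  p₁ p₂ : ℤ
  p₁ = proj₁ (realise (λ _ → true))
  p₂ = proj₁ (realise first)
  reads₁ = proj₂ (proj₂ (realise (λ _ → true)))
  reads₂ = proj₂ (proj₂ (realise first))

  chord-at : ∀ p → extend (base m n) p ≡ true → extend (base m n) (p -ℤ + D zero) ≡ true →
             Σ[ x ∈ Point ] Σ[ y ∈ Point ] p ≡ + at x × at x ≡ at y + D zero
  chord-at p one one′
    with q , refl , Bq ← extend-one p one | q′ , eq′ , Bq′ ← extend-one (p -ℤ + D zero) one′
    with x , refl ← base-one m n {q} Bq | y , refl ← base-one m n {q′} Bq′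
    = x , y , refl , -ℤ≡⇒≡+ eq′

  a-gap : corner m + suc m + suc m < cut m + suc (suc n)
  a-gap = <-witness (suc (suc n)) (lemma m n)
    where
    lemma : ∀ m n → suc m * 3 + 2 + suc m * 2 + 1 + suc (suc n)
                  ≡ suc m * 3 + 2 + suc m + suc m + suc (suc (suc n))
    lemma = ℕSolver.solve-∀

  b-gap : corner m + suc m + suc n < cut m + suc (suc n)
  b-gap = <-witness (suc (suc m)) (lemma m n)
    where
    lemma : ∀ m n → suc m * 3 + 2 + suc m * 2 + 1 + suc (suc n)
                  ≡ suc m * 3 + 2 + suc m + suc n + suc (suc (suc m))
    lemma = ℕSolver.solve-∀

  same-place : p₁ ≡ p₂
  same-place
    with x₁ , y₁ , p₁≡ , eq₁ ← chord-at p₁ (proj₁ (proj₂ (realise (λ _ → true)))) (reads₁ zero)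
       | x₂ , y₂ , p₂≡ , eq₂ ← chord-at p₂ (proj₁ (proj₂ (realise first))) (reads₂ zero)
    = begin
      p₁       ≡⟨ p₁≡ ⟩
      + at x₁  ≡⟨ cong (+_ ∘ at) (top-unique (m≢n ∘ ℕ.suc-injective) z<s a-gap b-gap {x₁} {y₁} {x₂} {y₂}
                                     (offsets-positive ps zero) eq₁ eq₂) ⟩
      + at x₂  ≡⟨ p₂≡ ⟨
      p₂       ∎

indicator-false : ∀ {xs q} → All (_≢ q) xs → indicator xs q ≡ false
indicator-false {xs} {q} ≢q = dec-false (q ∈? xs) (λ q∈ → All.lookup ≢q q∈ refl)

pair : Bool → Bool → Fin 2 → Bool
pair b₀ b₁ zero       = b₀
pair b₀ b₁ (suc zero) = b₁

-- On {c, c + a} + {0, c} the offsets a and c realise all four patterns of length 2.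
sumset-pointedWithin : ∀ c a len → 0 < a → a + a < c → c + c + a < len →
                       PointedWithin (indicator (c ∷ c + a ∷ c + c ∷ c + c + a ∷ [])) 2 len
sumset-pointedWithin c a len a>0 2a<c last<len = D , λ v → convert v (realise (v zero) (v (suc zero)))
  where
  ones : List ℕ
  ones = c ∷ c + a ∷ c + c ∷ c + c + a ∷ []

  F : ℕ → Bool
  F = indicator ones

  one : ∀ q → q ∈ ones → F q ≡ true
  one q = dec-true (q ∈? ones)

  D : Fin 2 → ℕ
  D zero       = a
  D (suc zero) = c

  a<c : a < c
  a<c = ℕ.<-trans (ℕ.m<m+n a a>0) 2a<c

  c≤2c : c ≤ c + c
  c≤2c = ℕ.m≤m+n c c

  2c≤last : c + c ≤ c + c + a
  2c≤last = ℕ.m≤m+n (c + c) a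

  c+a≤last : c + a ≤ c + c + a
  c+a≤last = ℕ.+-monoˡ-≤ a c≤2c

  ≤last⇒<len : ∀ {p} → p ≤ c + c + a → p < len
  ≤last⇒<len p≤ = ℕ.≤-<-trans p≤ last<len

  ≥c⇒>0 : ∀ {p} → c ≤ p → 0 < p
  ≥c⇒>0 = ℕ.<-≤-trans (ℕ.<-≤-trans a>0 (ℕ.<⇒≤ a<c))

  below : ∀ {q} → q < c → F q ≡ false
  below q<c = indicator-false (ℕ.>⇒≢ q<c
                             ∷ ℕ.>⇒≢ (ℕ.<-≤-trans q<c (ℕ.m≤m+n c a))
                             ∷ ℕ.>⇒≢ (ℕ.<-≤-trans q<c c≤2c)
                             ∷ ℕ.>⇒≢ (ℕ.<-≤-trans q<c (ℕ.≤-trans c≤2c 2c≤last)) ∷ [])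

  between : ∀ {q} → c + a < q → q < c + c → F q ≡ false
  between c+a<q q<2c = indicator-false (ℕ.<⇒≢ (ℕ.≤-<-trans (ℕ.m≤m+n c a) c+a<q)
                                     ∷ ℕ.<⇒≢ c+a<q
                                     ∷ ℕ.>⇒≢ q<2c
                                     ∷ ℕ.>⇒≢ (ℕ.<-≤-trans q<2c 2c≤last) ∷ [])

  realise : ∀ b₀ b₁ → RealisedWithin F D len (pair b₀ b₁)
  realise false false = realised c (≤last⇒<len (ℕ.≤-trans c≤2c 2c≤last)) (≥c⇒>0 ℕ.≤-refl)
    (λ { zero → ℕ.<⇒≤ a<c ; (suc zero) → ℕ.≤-refl })
    (one c (here refl))
    (λ { zero       → below (ℕ.∸-monoʳ-< a>0 (ℕ.<⇒≤ a<c))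
       ; (suc zero) → trans (cong F (ℕ.n∸n≡0 c)) (below (≥c⇒>0 ℕ.≤-refl)) })
  realise true false = realised (c + a) (≤last⇒<len c+a≤last) (≥c⇒>0 (ℕ.m≤m+n c a))
    (λ { zero → ℕ.m≤n+m a c ; (suc zero) → ℕ.m≤m+n c a })
    (one (c + a) (there (here refl)))
    (λ { zero       → trans (cong F (ℕ.m+n∸n≡m c a)) (one c (here refl))
       ; (suc zero) → trans (cong F (ℕ.m+n∸m≡n c a)) (below a<c) })
  realise false true = realised (c + c) (≤last⇒<len 2c≤last) (≥c⇒>0 c≤2c)
    (λ { zero → ℕ.≤-trans (ℕ.<⇒≤ a<c) c≤2c ; (suc zero) → c≤2c })
    (one (c + c) (there (there (here refl))))
    (λ { zero       → between c+a<2c-a 2c-a<2c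
       ; (suc zero) → trans (cong F (ℕ.m+n∸n≡m c c)) (one c (here refl)) })
    where
    a<c-a : a < c ∸ a
    a<c-a = subst (_< c ∸ a) (ℕ.m+n∸n≡m a a) (ℕ.∸-monoˡ-< 2a<c (ℕ.m≤n+m a a))
    c+a<2c-a : c + a < c + c ∸ a
    c+a<2c-a = subst (c + a <_) (sym (ℕ.+-∸-assoc c (ℕ.<⇒≤ a<c))) (ℕ.+-monoʳ-< c a<c-a)
    2c-a<2c : c + c ∸ a < c + c
    2c-a<2c = ℕ.∸-monoʳ-< a>0 (ℕ.≤-trans (ℕ.<⇒≤ a<c) c≤2c)
  realise true true = realised (c + c + a) (≤last⇒<len ℕ.≤-refl) (≥c⇒>0 (ℕ.≤-trans c≤2c 2c≤last))
    (λ { zero → ℕ.m≤n+m a (c + c) ; (suc zero) → ℕ.≤-trans c≤2c 2c≤last })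
    (one (c + c + a) (there (there (there (here refl)))))
    (λ { zero       → trans (cong F (ℕ.m+n∸n≡m (c + c) a)) (one (c + c) (there (there (here refl))))
       ; (suc zero) → trans (cong F (trans (cong (_∸ c) (ℕ.+-assoc c c a)) (ℕ.m+n∸m≡n c (c + a))))
                            (one (c + a) (there (here refl))) })

  convert : ∀ v → RealisedWithin F D len (pair (v zero) (v (suc zero))) → RealisedWithin F D len v
  convert v r = let open RealisedWithin r in
    realised pos pos<len pos>0 D≤pos one-at λ { zero → reads zero ; (suc zero) → reads (suc zero) }

base-diagonal : ∀ n → leftOnes n ++ map (_+_ (cut n)) (rightOnes n)
                    ≡ corner n ∷ corner n + suc n ∷ corner n + corner n ∷ corner n + corner n + suc n ∷ []
base-diagonal n =
  cong (λ xs → corner n ∷ corner n + suc n ∷ xs) (cong₂ (λ x y → x ∷ y ∷ []) (lemma₁ n) (lemma₂ n))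
  where
  lemma₁ : ∀ n → suc n * 3 + 2 + suc n * 2 + 1 + suc (suc n) ≡ suc n * 3 + 2 + (suc n * 3 + 2)
  lemma₁ = ℕSolver.solve-∀
  lemma₂ : ∀ n → suc n * 3 + 2 + suc n * 2 + 1 + (suc (suc n) + suc n)
                 ≡ suc n * 3 + 2 + (suc n * 3 + 2) + suc n
  lemma₂ = ℕSolver.solve-∀

base-pointedWithin : ∀ n → PointedWithin (base n n) 2 (cut n + rightLength n)
base-pointedWithin n =
  subst (λ xs → PointedWithin (indicator xs) 2 (cut n + rightLength n)) (sym (base-diagonal n))
  (sumset-pointedWithin (corner n) (suc n) (cut n + rightLength n) z<s
    (<-witness (suc (suc n)) (lemma₁ n)) (<-witness 0 (lemma₂ n)))
  where
  lemma₁ : ∀ n → suc n * 3 + 2 ≡ suc n + suc n + suc (suc (suc n))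
  lemma₁ = ℕSolver.solve-∀
  lemma₂ : ∀ n → suc n * 3 + 2 + suc n * 2 + 1 + (suc (suc n) + suc n + 1)
                 ≡ suc n * 3 + 2 + (suc n * 3 + 2) + suc n + 1
  lemma₂ = ℕSolver.solve-∀

-- Follower sets

prefixWord : ℕ → ℕ → Word
prefixWord N m = blowUpWord^ N (applyUpTo (indicator (leftOnes m)) (cut m))

suffixWord : ℕ → ℕ → Word
suffixWord N n = blowUpWord^ N (applyUpTo (indicator (rightOnes n)) (rightLength n))

window-base : ∀ N m n → applyUpTo (blowUp^ N (base m n)) ((cut m + rightLength n) * 3 ^ N)
                        ≡ prefixWord N m ++ suffixWord N n
window-base N m n = begin
  applyUpTo (blowUp^ N (base m n)) ((cut m + rightLength n) * 3 ^ N)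
    ≡⟨ window-blowUp^ N (base m n) (cut m + rightLength n) ⟩
  blowUpWord^ N (applyUpTo (base m n) (cut m + rightLength n))
    ≡⟨ cong (blowUpWord^ N) (window-splice (rightLength n) (leftOnes m) (rightOnes n) (leftOnes<cut m)) ⟩
  blowUpWord^ N (applyUpTo (indicator (leftOnes m)) (cut m)
                   ++ applyUpTo (indicator (rightOnes n)) (rightLength n))
    ≡⟨ blowUpWord^-++ N _ _ ⟩
  prefixWord N m ++ suffixWord N n
    ∎

blownUpBase : ℕ → ℕ → ℕ → Seq
blownUpBase N m n = extend (blowUp^ N (base m n))

blownUpBase-V≤ : ∀ N {m n} → m ≢ n → V≤ (N + 2) (blownUpBase N m n)
blownUpBase-V≤ N m≢n B unique shattered = ℕ.≮⇒≥ λ N+2<|B| →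
  base-not-pointed m≢n (blowUp^-pointed N (shattered⇒pointed (N + 2) unique shattered N+2<|B|))

prefix-suffix-occurs : ∀ N m n → OccursIn (prefixWord N m ++ suffixWord N n) (blownUpBase N m n)
prefix-suffix-occurs N m n =
  subst (λ w → OccursIn w (blownUpBase N m n)) (window-base N m n) (occursIn-extend _ _)

split-occurs : ∀ N m n →
               OccursIn (prefixWord N m) (blownUpBase N m n) × OccursIn (suffixWord N n) (blownUpBase N m n)
split-occurs N m n = occursIn-++ (prefixWord N m) (blownUpBase N m n) (prefix-suffix-occurs N m n)

prefix-in-language : ∀ N m → Lang (V≤ (N + 2)) (prefixWord N m)
prefix-in-language N m =
  blownUpBase N m (suc m) , blownUpBase-V≤ N (ℕ.1+n≢n ∘ sym) , proj₁ (split-occurs N m (suc m))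

suffix-follows : ∀ N {m n} → m ≢ n → Follower (V≤ (N + 2)) (prefixWord N m) (suffixWord N n)
suffix-follows N {m} {n} m≢n =
  (blownUpBase N m n , blownUpBase-V≤ N m≢n , proj₂ (split-occurs N m n)) ,
  (blownUpBase N m n , blownUpBase-V≤ N m≢n , prefix-suffix-occurs N m n)

diagonal-not-in-language : ∀ N n → ¬ Lang (V≤ (N + 2)) (prefixWord N n ++ suffixWord N n)
diagonal-not-in-language N n (S , vc , occ) = pointed⇒¬VCAtMost
  (pointedWithin⇒pointed {S = S} (blowUp^-pointedWithin N (base-pointedWithin n))
                         (subst (λ w → OccursIn w S) (sym (window-base N n n)) occ))
  vc

distinct-followers⇒¬sofic : ∀ {X} (W : ℕ → Word) → (∀ m → Lang X (W m)) →
                            (∀ {m n} → m < n → ¬ SameFollower X (W m) (W n)) → ¬ Sofic X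
distinct-followers⇒¬sofic {X} W W∈X distinct (ws , _ , represented) =
  let i , j , i<j , same-class = pigeonhole (ℕ.n<1+n (length ws)) class in
  distinct i<j λ z → ⇔.trans (same i z) (⇔.sym (subst (λ w → Follower X (W (toℕ j)) z ⇔ Follower X w z)
                                                    (cong (lookup ws) (sym same-class)) (same j z)))
  where
  class : Fin (suc (length ws)) → Fin (length ws)
  class m = Any.index (represented (W (toℕ m)) (W∈X (toℕ m)))

  same : ∀ m → SameFollower X (W (toℕ m)) (lookup ws (class m))
  same m = lookup-index (represented (W (toℕ m)) (W∈X (toℕ m)))

V≤-not-sofic : ∀ N → ¬ Sofic (V≤ (N + 2))
V≤-not-sofic N = distinct-followers⇒¬sofic (prefixWord N) (prefix-in-language N) λ {m} {n} m<n same →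
  diagonal-not-in-language N n
    (proj₂ (Equivalence.to (same (suffixWord N n)) (suffix-follows N (ℕ.<⇒≢ m<n))))

theorem6 : (d : ℕ) → 1 < d → ¬ Sofic (V≤ d)
theorem6 (suc (suc N)) (s≤s (s≤s z≤n)) = subst (λ d → ¬ Sofic (V≤ d)) (ℕ.+-comm N 2) (V≤-not-sofic N)
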